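{- Let $G$ be an $m$-regular graph on $2n$ vertices, where $3\le n-1\le m<2n$. Then $D(G,x)$ is unimodal with a mode at $n$.
   Context: $G$ is a finite simple graph; $m$-regular means every vertex has degree $m$. A set $U$ of vertices is dominating if every vertex is in $U$ or adjacent to a vertex of $U$; $d_i(G)$ counts dominating sets of size $i$ and $D(G,x)=\sum_i d_i(G)x^i$. A polynomial is unimodal if its coefficients (ordered by increasing power of $x$) are non-decreasing then non-increasing; it has a mode at $k$ if the coefficient of $x^k$ is maximum. -}

module Defs where

open import Data.Nat using (ℕ; zero; suc; _≤_; _<_; _≟_)
open import Data.Bool using (Bool; true; false; T)
open import Data.Fin using (Fin)
open import Data.Fin.Subset using (Subset; _∈_; ∣_∣)
open import Data.Fin.Subset.Properties using (_∈?_)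
open import Data.Vec using ([]; _∷_)
open import Data.List using (List; []; _∷_; map; _++_; filter; length; allFin)
open import Data.Product using (Σ; ∃; _×_; _,_)
open import Data.Sum using (_⊎_)
open import Relation.Nullary using (Dec; ¬_)
open import Relation.Nullary.Decidable using (_×-dec_; _⊎-dec_)
open import Relation.Binary.PropositionalEquality using (_≡_)
open import Data.List.Relation.Unary.All using (All; all?)
open import Data.List.Relation.Unary.Any using (Any; any?)

record Graph (N : ℕ) : Set where
  field
    adj   : Fin N → Fin N → Bool
    sym   : ∀ i j → adj i j ≡ adj j i
    irrefl : ∀ i → adj i i ≡ false
open Graph public

Adj : ∀ {N} → Graph N → Fin N → Fin N → Set
Adj G i j = T (adj G i j)

neighbours : ∀ {N} → Graph N → Fin N → List (Fin N)
neighbours G i = filter (λ j → Data.Bool.T? (adj G i j)) (allFin _)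
  where import Data.Bool

degree : ∀ {N} → Graph N → Fin N → ℕ
degree G i = length (neighbours G i)

Regular : ∀ {N} → ℕ → Graph N → Set
Regular m G = ∀ i → degree G i ≡ m

Dominating : ∀ {N} → Graph N → Subset N → Set
Dominating {N} G U = ∀ (v : Fin N) → v ∈ U ⊎ Σ (Fin N) (λ u → u ∈ U × Adj G v u)

dominating? : ∀ {N} (G : Graph N) (U : Subset N) → Dec (Dominating G U)
dominating? {N} G U =
  Data.Fin.Properties.all? (λ v → (v ∈? U) ⊎-dec
    Data.Fin.Properties.any? (λ u → (u ∈? U) ×-dec Data.Bool.T? (adj G v u)))
  where import Data.Fin.Properties
        import Data.Bool

allSubsets : (N : ℕ) → List (Subset N)
allSubsets zero = [] ∷ []
allSubsets (suc N) = map (true ∷_) (allSubsets N) ++ map (false ∷_) (allSubsets N)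

d : ∀ {N} → Graph N → ℕ → ℕ
d {N} G i = length (filter (λ U → dominating? G U ×-dec (∣ U ∣ ≟ i)) (allSubsets N))

-- A coefficient sequence a (a_i = coefficient of x^i) is unimodal with a mode at k:
-- non-decreasing up to k, non-increasing from k on, and a_k is maximum.
UnimodalWithModeAt : (ℕ → ℕ) → ℕ → Set
UnimodalWithModeAt a k =
  (∀ i → suc i ≤ k → a i ≤ a (suc i)) ×
  (∀ i → k ≤ i → a (suc i) ≤ a i) ×
  (∀ i → a i ≤ a k)

-- Supersets of dominating sets dominate, so the dominating sets form an up-closed family 𝓕 of subsets
-- of the N = 2n vertices. Counting the pairs S ⊂ T in 𝓕 with |T| = |S| + 1 = i + 1 from both ends gives
-- (N − i)·d_i ≤ (i + 1)·d_{i+1}, so d_i increases as long as i < n.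
-- A set fails to dominate only when it avoids some closed neighbourhood N[v], i.e. lies in V ∖ N[v],
-- which has at most n vertices since deg v ≥ n − 1. Hence every set of more than n vertices dominates,
-- d_i = C(2n, i) decreases for i > n, and at most 2n sets of size n fail to dominate. The last step
-- d_{n+1} ≤ d_n then reduces to 2n(n + 1) ≤ C(2n, n), which holds for n ≥ 4 because C(2n, 3) ≤ C(2n, n).

module Submission where

open import Data.Bool using (Bool; true; false; not; _∧_; _∨_; if_then_else_; T)
open import Data.Bool.Properties using (∨-zeroʳ; ∨-identityʳ)
open import Data.Fin using (Fin; zero; suc; _≟_)
open import Data.Fin.Subset using (Subset; inside; outside; ∣_∣; _∈_; _⊆_; ∁)
open import Data.Fin.Subset.Properties using (_∈?_; _⊆?_; ∣∁p∣≡n∸∣p∣; x∉p⇒x∈∁p)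
open import Data.Fin.Properties using (any?; ¬∀⟶∃¬)
open import Data.Product using (Σ; ∃-syntax; _×_; _,_; proj₁; proj₂; map₁; map₂)
open import Data.Sum using (_⊎_; inj₁; inj₂)
import Data.Sum as Sum
open import Data.List using (List; []; _∷_; _++_; map; filter; length; allFin; tabulate)
open import Data.List.Membership.Propositional using () renaming (_∈_ to _∈ˡ_)
open import Data.List.Membership.Propositional.Properties using (∈-allFin)
open import Data.List.Properties using (map-tabulate; length-tabulate)
open import Data.List.Relation.Unary.Any using (here; there)
open import Data.Nat using (ℕ; zero; suc; _+_; _*_; _∸_; _≤_; _<_; _≡ᵇ_; z≤n; s≤s; >-nonZero)
open import Data.Nat.Properties hiding (_≟_)
open import Algebra.Properties.CommutativeSemigroup +-commutativeSemigroup using () renaming (interchange to +-interchange)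
open import Algebra.Properties.CommutativeSemigroup *-commutativeSemigroup using () renaming (x∙yz≈y∙xz to *-exchange; x∙yz≈zy∙x to *-reverse)
import Data.Nat.Properties as ℕ
open import Data.Vec using ([]; _∷_; lookup; _[_]≔_)
import Data.Vec as Vec
open import Data.Vec.Properties using (lookup-map; lookup∘tabulate; []=⇒lookup; updateAt-updates; updateAt-minimal)
open import Function using (_∘_; id)
open import Relation.Nullary using (Dec; yes; no; does; ¬_)
open import Relation.Nullary.Decidable using (_×-dec_; _⊎-dec_; T?; dec-true)
open import Relation.Binary.PropositionalEquality
open import Data.Nat.Solver using (module +-*-Solver)
open +-*-Solver using (solve; _:=_; _:+_; _:*_; con)

open import Defs using (Graph; adj; irrefl; Adj; degree; Regular; Dominating; dominating?; allSubsets; d; UnimodalWithModeAt)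

-- Finite sums

𝟙 : Bool → ℕ
𝟙 true  = 1
𝟙 false = 0

𝟙≤1 : ∀ b → 𝟙 b ≤ 1
𝟙≤1 true  = ≤-refl
𝟙≤1 false = z≤n

∑ : ∀ {a} {A : Set a} → List A → (A → ℕ) → ℕ
∑ []       f = 0
∑ (x ∷ xs) f = f x + ∑ xs f

module _ {a} {A : Set a} where

  ∑-++ : ∀ (xs ys : List A) (f : A → ℕ) → ∑ (xs ++ ys) f ≡ ∑ xs f + ∑ ys f
  ∑-++ []       ys f = refl
  ∑-++ (x ∷ xs) ys f = trans (cong (f x +_) (∑-++ xs ys f)) (sym (+-assoc (f x) _ _))

  ∑-map : ∀ {b} {B : Set b} (g : B → A) (xs : List B) (f : A → ℕ) → ∑ (map g xs) f ≡ ∑ xs (f ∘ g)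
  ∑-map g []       f = refl
  ∑-map g (x ∷ xs) f = cong (f (g x) +_) (∑-map g xs f)

  ∑-cong : ∀ (xs : List A) {f g : A → ℕ} → (∀ x → f x ≡ g x) → ∑ xs f ≡ ∑ xs g
  ∑-cong []       f≗g = refl
  ∑-cong (x ∷ xs) f≗g = cong₂ _+_ (f≗g x) (∑-cong xs f≗g)

  ∑-mono-≤ : ∀ (xs : List A) {f g : A → ℕ} → (∀ x → f x ≤ g x) → ∑ xs f ≤ ∑ xs g
  ∑-mono-≤ []       f≤g = z≤n
  ∑-mono-≤ (x ∷ xs) f≤g = +-mono-≤ (f≤g x) (∑-mono-≤ xs f≤g)

  ∑-zero : ∀ (xs : List A) → ∑ xs (λ _ → 0) ≡ 0
  ∑-zero []       = refl
  ∑-zero (x ∷ xs) = ∑-zero xs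

  ∑-one : ∀ (xs : List A) → ∑ xs (λ _ → 1) ≡ length xs
  ∑-one []       = refl
  ∑-one (x ∷ xs) = cong suc (∑-one xs)

  ∑-distrib-+ : ∀ (xs : List A) (f g : A → ℕ) → ∑ xs (λ x → f x + g x) ≡ ∑ xs f + ∑ xs g
  ∑-distrib-+ []       f g = refl
  ∑-distrib-+ (x ∷ xs) f g =
    trans (cong (f x + g x +_) (∑-distrib-+ xs f g)) (+-interchange (f x) (g x) (∑ xs f) (∑ xs g))

  ∑-*ˡ : ∀ (xs : List A) c (f : A → ℕ) → ∑ xs (λ x → c * f x) ≡ c * ∑ xs f
  ∑-*ˡ []       c f = sym (*-zeroʳ c)
  ∑-*ˡ (x ∷ xs) c f = trans (cong (c * f x +_) (∑-*ˡ xs c f)) (sym (*-distribˡ-+ c (f x) _))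

  ∑-comm : ∀ {b} {B : Set b} (xs : List A) (ys : List B) (h : A → B → ℕ) →
           ∑ xs (λ x → ∑ ys (h x)) ≡ ∑ ys (λ y → ∑ xs (λ x → h x y))
  ∑-comm xs []       h = ∑-zero xs
  ∑-comm xs (y ∷ ys) h =
    trans (∑-distrib-+ xs (λ x → h x y) _) (cong (∑ xs (λ x → h x y) +_) (∑-comm xs ys h))

  ∈⇒≤∑ : ∀ {x} {xs : List A} (f : A → ℕ) → x ∈ˡ xs → f x ≤ ∑ xs f
  ∈⇒≤∑ f (here refl) = m≤m+n _ _
  ∈⇒≤∑ f (there x∈xs) = ≤-trans (∈⇒≤∑ f x∈xs) (m≤n+m _ _)

  length-filter≡∑ : ∀ {p} {P : A → Set p} (P? : ∀ x → Dec (P x)) (xs : List A) →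
                    length (filter P? xs) ≡ ∑ xs (𝟙 ∘ does ∘ P?)
  length-filter≡∑ P? []       = refl
  length-filter≡∑ P? (x ∷ xs) with does (P? x)
  ... | true  = cong suc (length-filter≡∑ P? xs)
  ... | false = length-filter≡∑ P? xs

∑-allFin-suc : ∀ {N} (f : Fin (suc N) → ℕ) → ∑ (allFin (suc N)) f ≡ f zero + ∑ (allFin N) (f ∘ suc)
∑-allFin-suc {N} f = cong (f zero +_) (begin
  ∑ (tabulate suc) f           ≡⟨ cong (λ xs → ∑ xs f) (map-tabulate id suc) ⟨
  ∑ (map suc (allFin N)) f     ≡⟨ ∑-map suc (allFin N) f ⟩
  ∑ (allFin N) (f ∘ suc)       ∎)
  where open ≡-Reasoning

∑-allFin-one : ∀ N → ∑ (allFin N) (λ _ → 1) ≡ N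
∑-allFin-one N = trans (∑-one (allFin N)) (length-tabulate id)

∑-allSubsets-suc : ∀ {N} (f : Subset (suc N) → ℕ) →
  ∑ (allSubsets (suc N)) f ≡ ∑ (allSubsets N) (λ S → f (inside ∷ S)) + ∑ (allSubsets N) (λ S → f (outside ∷ S))
∑-allSubsets-suc {N} f =
  trans (∑-++ (map (inside ∷_) (allSubsets N)) _ f)
        (cong₂ _+_ (∑-map (inside ∷_) (allSubsets N) f) (∑-map (outside ∷_) (allSubsets N) f))

∣p∣≡∑ : ∀ {N} (p : Subset N) → ∣ p ∣ ≡ ∑ (allFin N) (𝟙 ∘ lookup p)
∣p∣≡∑ []            = refl
∣p∣≡∑ (inside ∷ p)  = trans (cong suc (∣p∣≡∑ p)) (sym (∑-allFin-suc (𝟙 ∘ lookup (inside ∷ p))))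
∣p∣≡∑ (outside ∷ p) = trans (∣p∣≡∑ p) (sym (∑-allFin-suc (𝟙 ∘ lookup (outside ∷ p))))

∣p∣≡suc∣p[x]≔outside∣ : ∀ {N} (p : Subset N) x → lookup p x ≡ inside → ∣ p ∣ ≡ suc ∣ p [ x ]≔ outside ∣
∣p∣≡suc∣p[x]≔outside∣ (inside ∷ p)  zero    _    = refl
∣p∣≡suc∣p[x]≔outside∣ (inside ∷ p)  (suc x) x∈p = cong suc (∣p∣≡suc∣p[x]≔outside∣ p x x∈p)
∣p∣≡suc∣p[x]≔outside∣ (outside ∷ p) (suc x) x∈p = ∣p∣≡suc∣p[x]≔outside∣ p x x∈p

∣∁p∣≡∑ : ∀ {N} (p : Subset N) → ∣ ∁ p ∣ ≡ ∑ (allFin N) (𝟙 ∘ not ∘ lookup p)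
∣∁p∣≡∑ {N} p = trans (∣p∣≡∑ (∁ p)) (∑-cong (allFin N) (λ x → cong 𝟙 (lookup-map x not p)))

-- Counting subsets layer by layer

-- Inserting x into S ∌ x and deleting x from T ∋ x are mutually inverse.
∑-insert≡∑-delete-at : ∀ {N} (x : Fin N) (F : Subset N → Subset N → ℕ) →
  ∑ (allSubsets N) (λ S → if lookup S x then 0 else F (S [ x ]≔ inside) S) ≡
  ∑ (allSubsets N) (λ T → if lookup T x then F T (T [ x ]≔ outside) else 0)
∑-insert≡∑-delete-at {suc N} zero F = begin
  ∑ (allSubsets (suc N)) insertions                               ≡⟨ ∑-allSubsets-suc insertions ⟩
  ∑ (allSubsets N) (λ _ → 0) + ∑ (allSubsets N) F⁺⁻                ≡⟨ +-comm (∑ (allSubsets N) (λ _ → 0)) (∑ (allSubsets N) F⁺⁻) ⟩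
  ∑ (allSubsets N) F⁺⁻ + ∑ (allSubsets N) (λ _ → 0)                ≡⟨ ∑-allSubsets-suc deletions ⟨
  ∑ (allSubsets (suc N)) deletions                                ∎
  where
  open ≡-Reasoning
  insertions deletions : Subset (suc N) → ℕ
  insertions S = if lookup S zero then 0 else F (S [ zero ]≔ inside) S
  deletions T = if lookup T zero then F T (T [ zero ]≔ outside) else 0
  F⁺⁻ : Subset N → ℕ
  F⁺⁻ S = F (inside ∷ S) (outside ∷ S)
∑-insert≡∑-delete-at {suc N} (suc x) F = begin
  ∑ (allSubsets (suc N)) insertions
    ≡⟨ ∑-allSubsets-suc insertions ⟩
  ∑ (allSubsets N) (λ S → insertions (inside ∷ S)) + ∑ (allSubsets N) (λ S → insertions (outside ∷ S))
    ≡⟨ cong₂ _+_ (∑-insert≡∑-delete-at x (λ T S → F (inside ∷ T) (inside ∷ S)))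
                 (∑-insert≡∑-delete-at x (λ T S → F (outside ∷ T) (outside ∷ S))) ⟩
  ∑ (allSubsets N) (λ T → deletions (inside ∷ T)) + ∑ (allSubsets N) (λ T → deletions (outside ∷ T))
    ≡⟨ ∑-allSubsets-suc deletions ⟨
  ∑ (allSubsets (suc N)) deletions
    ∎
  where
  open ≡-Reasoning
  insertions deletions : Subset (suc N) → ℕ
  insertions S = if lookup S (suc x) then 0 else F (S [ suc x ]≔ inside) S
  deletions T = if lookup T (suc x) then F T (T [ suc x ]≔ outside) else 0

∑-insert≡∑-delete : ∀ {N} (F : Subset N → Subset N → ℕ) →
  ∑ (allSubsets N) (λ S → ∑ (allFin N) (λ x → if lookup S x then 0 else F (S [ x ]≔ inside) S)) ≡
  ∑ (allSubsets N) (λ T → ∑ (allFin N) (λ x → if lookup T x then F T (T [ x ]≔ outside) else 0))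
∑-insert≡∑-delete {N} F = begin
  _  ≡⟨ ∑-comm (allSubsets N) (allFin N) insertions ⟩
  _  ≡⟨ ∑-cong (allFin N) (λ x → ∑-insert≡∑-delete-at x F) ⟩
  _  ≡⟨ ∑-comm (allSubsets N) (allFin N) deletions ⟨
  _  ∎
  where
  open ≡-Reasoning
  insertions deletions : Subset N → Fin N → ℕ
  insertions S x = if lookup S x then 0 else F (S [ x ]≔ inside) S
  deletions T x = if lookup T x then F T (T [ x ]≔ outside) else 0

layer : ∀ {N} → (Subset N → Bool) → ℕ → Subset N → Bool
layer p i S = p S ∧ (∣ S ∣ ≡ᵇ i)

count : ∀ N → (Subset N → Bool) → ℕ → ℕ
count N p i = ∑ (allSubsets N) (𝟙 ∘ layer p i)

binomial : ℕ → ℕ → ℕ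
binomial N = count N (λ _ → true)

∑-layer : ∀ {N} (p : Subset N → Bool) i (f : ℕ → ℕ) →
  ∑ (allSubsets N) (λ S → 𝟙 (layer p i S) * f ∣ S ∣) ≡ f i * count N p i
∑-layer {N} p i f = trans (∑-cong (allSubsets N) on-layer) (∑-*ˡ (allSubsets N) (f i) _)
  where
  on-layer : ∀ S → 𝟙 (layer p i S) * f ∣ S ∣ ≡ f i * 𝟙 (layer p i S)
  on-layer S with p S
  ... | false = sym (*-zeroʳ (f i))
  ... | true with ∣ S ∣ ≡ᵇ i in eq
  ...   | false = sym (*-zeroʳ (f i))
  ...   | true  = begin
    1 * f ∣ S ∣  ≡⟨ *-identityˡ _ ⟩
    f ∣ S ∣      ≡⟨ cong f (≡ᵇ⇒≡ ∣ S ∣ i (subst T (sym eq) _)) ⟩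
    f i          ≡⟨ *-identityʳ _ ⟨
    f i * 1      ∎
    where open ≡-Reasoning

upDegree : ∀ {N} → (Subset N → Bool) → Subset N → ℕ
upDegree {N} p S = ∑ (allFin N) (λ x → if lookup S x then 0 else 𝟙 (p (S [ x ]≔ inside)))

downDegree : ∀ {N} → (Subset N → Bool) → Subset N → ℕ
downDegree {N} p T = ∑ (allFin N) (λ x → if lookup T x then 𝟙 (p (T [ x ]≔ outside)) else 0)

-- Both sides count the pairs S ⊂ T of members of p with |S| = i and |T| = i + 1.
double-counting : ∀ {N} (p : Subset N → Bool) i →
  ∑ (allSubsets N) (λ S → 𝟙 (layer p i S) * upDegree p S) ≡
  ∑ (allSubsets N) (λ T → 𝟙 (layer p (suc i) T) * downDegree p T)
double-counting {N} p i = begin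
  ∑ subsets (λ S → 𝟙 (layer p i S) * upDegree p S)
    ≡⟨ ∑-cong subsets (λ S → trans (sym (∑-*ˡ (allFin N) (𝟙 (layer p i S)) (up S)))
                                   (∑-cong (allFin N) (insertion S))) ⟩
  ∑ subsets (λ S → ∑ (allFin N) (λ x → if lookup S x then 0 else F (S [ x ]≔ inside) S))
    ≡⟨ ∑-insert≡∑-delete F ⟩
  ∑ subsets (λ T → ∑ (allFin N) (λ x → if lookup T x then F T (T [ x ]≔ outside) else 0))
    ≡⟨ ∑-cong subsets (λ T → trans (∑-cong (allFin N) (deletion T))
                                   (∑-*ˡ (allFin N) (𝟙 (layer p (suc i) T)) (down T))) ⟩
  ∑ subsets (λ T → 𝟙 (layer p (suc i) T) * downDegree p T)
    ∎
  where
  open ≡-Reasoning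
  subsets = allSubsets N

  up down : Subset N → Fin N → ℕ
  up S x = if lookup S x then 0 else 𝟙 (p (S [ x ]≔ inside))
  down T x = if lookup T x then 𝟙 (p (T [ x ]≔ outside)) else 0

  F : Subset N → Subset N → ℕ
  F T S = 𝟙 (layer p i S) * 𝟙 (p T)

  insertion : ∀ S x → 𝟙 (layer p i S) * up S x ≡ (if lookup S x then 0 else F (S [ x ]≔ inside) S)
  insertion S x with lookup S x
  ... | true  = *-zeroʳ (𝟙 (layer p i S))
  ... | false = refl

  𝟙-∧-swap : ∀ a b c → 𝟙 (a ∧ c) * 𝟙 b ≡ 𝟙 (b ∧ c) * 𝟙 a
  𝟙-∧-swap false false c = refl
  𝟙-∧-swap false true  c = sym (*-zeroʳ (𝟙 c))
  𝟙-∧-swap true  false c = *-zeroʳ (𝟙 c)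
  𝟙-∧-swap true  true  c = refl

  deletion : ∀ T x → (if lookup T x then F T (T [ x ]≔ outside) else 0) ≡ 𝟙 (layer p (suc i) T) * down T x
  deletion T x with lookup T x in x∈T
  ... | false = sym (*-zeroʳ (𝟙 (layer p (suc i) T)))
  ... | true  rewrite ∣p∣≡suc∣p[x]≔outside∣ T x x∈T =
    𝟙-∧-swap (p (T [ x ]≔ outside)) (p T) (∣ T [ x ]≔ outside ∣ ≡ᵇ i)

UpClosed : ∀ {N} → (Subset N → Bool) → Set
UpClosed {N} p = ∀ S (x : Fin N) → T (p S) → T (p (S [ x ]≔ inside))

𝟙-T : ∀ {b} → T b → 𝟙 b ≡ 1
𝟙-T {true} _ = refl

upDegree-upClosed : ∀ {N} {p : Subset N → Bool} → UpClosed p → ∀ S → T (p S) → upDegree p S ≡ ∣ ∁ S ∣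
upDegree-upClosed {N} {p} up S pS = trans (∑-cong (allFin N) term) (sym (∣∁p∣≡∑ S))
  where
  term : ∀ x → (if lookup S x then 0 else 𝟙 (p (S [ x ]≔ inside))) ≡ 𝟙 (not (lookup S x))
  term x with lookup S x
  ... | true  = refl
  ... | false = 𝟙-T (up S x pS)

downDegree≤∣p∣ : ∀ {N} (p : Subset N → Bool) T → downDegree p T ≤ ∣ T ∣
downDegree≤∣p∣ {N} p T = ≤-trans (∑-mono-≤ (allFin N) term) (≤-reflexive (sym (∣p∣≡∑ T)))
  where
  term : ∀ x → (if lookup T x then 𝟙 (p (T [ x ]≔ outside)) else 0) ≤ 𝟙 (lookup T x)
  term x with lookup T x
  ... | true  = 𝟙≤1 _
  ... | false = z≤n

downDegree-all : ∀ {N} (T : Subset N) → downDegree (λ _ → true) T ≡ ∣ T ∣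
downDegree-all {N} T = trans (∑-cong (allFin N) term) (sym (∣p∣≡∑ T))
  where
  term : ∀ x → (if lookup T x then 1 else 0) ≡ 𝟙 (lookup T x)
  term x with lookup T x
  ... | true  = refl
  ... | false = refl

upClosed-double-counting : ∀ {N} {p : Subset N → Bool} → UpClosed p → ∀ i →
  (N ∸ i) * count N p i ≡ ∑ (allSubsets N) (λ T → 𝟙 (layer p (suc i) T) * downDegree p T)
upClosed-double-counting {N} {p} up i = begin
  (N ∸ i) * count N p i                                     ≡⟨ ∑-layer p i (N ∸_) ⟨
  ∑ (allSubsets N) (λ S → 𝟙 (layer p i S) * (N ∸ ∣ S ∣))     ≡⟨ ∑-cong (allSubsets N) on-layer ⟨
  ∑ (allSubsets N) (λ S → 𝟙 (layer p i S) * upDegree p S)   ≡⟨ double-counting p i ⟩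
  ∑ (allSubsets N) (λ T → 𝟙 (layer p (suc i) T) * downDegree p T) ∎
  where
  open ≡-Reasoning
  on-layer : ∀ S → 𝟙 (layer p i S) * upDegree p S ≡ 𝟙 (layer p i S) * (N ∸ ∣ S ∣)
  on-layer S with p S in pS
  ... | false = refl
  ... | true  = cong (𝟙 (∣ S ∣ ≡ᵇ i) *_)
                     (trans (upDegree-upClosed up S (subst T (sym pS) _)) (∣∁p∣≡n∸∣p∣ S))

count-step-upClosed : ∀ {N} {p : Subset N → Bool} → UpClosed p → ∀ i →
  (N ∸ i) * count N p i ≤ suc i * count N p (suc i)
count-step-upClosed {N} {p} up i = begin
  (N ∸ i) * count N p i
    ≡⟨ upClosed-double-counting up i ⟩
  ∑ (allSubsets N) (λ T → 𝟙 (layer p (suc i) T) * downDegree p T)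
    ≤⟨ ∑-mono-≤ (allSubsets N) (λ T → *-monoʳ-≤ (𝟙 (layer p (suc i) T)) (downDegree≤∣p∣ p T)) ⟩
  ∑ (allSubsets N) (λ T → 𝟙 (layer p (suc i) T) * ∣ T ∣)
    ≡⟨ ∑-layer p (suc i) id ⟩
  suc i * count N p (suc i)
    ∎
  where open ≤-Reasoning

all-upClosed : ∀ {N} → UpClosed {N} (λ _ → true)
all-upClosed _ _ _ = _

binomial-step : ∀ N i → suc i * binomial N (suc i) ≡ (N ∸ i) * binomial N i
binomial-step N i = begin
  suc i * binomial N (suc i)
    ≡⟨ ∑-layer all (suc i) id ⟨
  ∑ (allSubsets N) (λ T → 𝟙 (layer all (suc i) T) * ∣ T ∣)
    ≡⟨ ∑-cong (allSubsets N) (λ T → cong (𝟙 (layer all (suc i) T) *_) (downDegree-all T)) ⟨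
  ∑ (allSubsets N) (λ T → 𝟙 (layer all (suc i) T) * downDegree all T)
    ≡⟨ upClosed-double-counting all-upClosed i ⟨
  (N ∸ i) * binomial N i
    ∎
  where
  open ≡-Reasoning
  all : Subset N → Bool
  all _ = true

binomial-zero : ∀ N → binomial N 0 ≡ 1
binomial-zero zero    = refl
binomial-zero (suc N) = begin
  binomial (suc N) 0                                         ≡⟨ ∑-allSubsets-suc {N} (𝟙 ∘ layer (λ _ → true) 0) ⟩
  ∑ (allSubsets N) (λ _ → 0) + binomial N 0                   ≡⟨ cong (_+ binomial N 0) (∑-zero (allSubsets N)) ⟩
  binomial N 0                                               ≡⟨ binomial-zero N ⟩
  1                                                          ∎
  where open ≡-Reasoning

count-increasing : ∀ {N} {p : Subset N → Bool} → UpClosed p → ∀ {i} → suc i ≤ N ∸ i →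
  count N p i ≤ count N p (suc i)
count-increasing {N} {p} up {i} 1+i≤N∸i = *-cancelˡ-≤ (N ∸ i) {{>-nonZero (≤-trans (s≤s z≤n) 1+i≤N∸i)}} (begin
  (N ∸ i) * count N p i        ≤⟨ count-step-upClosed up i ⟩
  suc i * count N p (suc i)    ≤⟨ *-monoˡ-≤ (count N p (suc i)) 1+i≤N∸i ⟩
  (N ∸ i) * count N p (suc i)  ∎)
  where open ≤-Reasoning

binomial-decreasing : ∀ {N i} → N ∸ i ≤ suc i → binomial N (suc i) ≤ binomial N i
binomial-decreasing {N} {i} N∸i≤1+i = *-cancelˡ-≤ (suc i) (begin
  suc i * binomial N (suc i)  ≡⟨ binomial-step N i ⟩
  (N ∸ i) * binomial N i      ≤⟨ *-monoˡ-≤ (binomial N i) N∸i≤1+i ⟩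
  suc i * binomial N i        ∎)
  where open ≤-Reasoning

unimodal-from-steps : ∀ (a : ℕ → ℕ) k →
  (∀ i → suc i ≤ k → a i ≤ a (suc i)) → (∀ i → k ≤ i → a (suc i) ≤ a i) →
  UnimodalWithModeAt a k
unimodal-from-steps a k rise fall = rise , fall , mode
  where
  ascend : ∀ {i j} → i ≤ j → j ≤ k → a i ≤ a j
  ascend {j = zero}  z≤n    _ = ≤-refl
  ascend {j = suc j} i≤1+j 1+j≤k with m≤n⇒m<n∨m≡n i≤1+j
  ... | inj₁ (s≤s i≤j) = ≤-trans (ascend i≤j (<⇒≤ 1+j≤k)) (rise j 1+j≤k)
  ... | inj₂ refl      = ≤-refl

  descend : ∀ {j} → k ≤ j → a j ≤ a k
  descend {zero}  z≤n   = ≤-refl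
  descend {suc j} k≤1+j with m≤n⇒m<n∨m≡n k≤1+j
  ... | inj₁ (s≤s k≤j) = ≤-trans (fall j k≤j) (descend k≤j)
  ... | inj₂ refl      = ≤-refl

  mode : ∀ i → a i ≤ a k
  mode i with ≤-total i k
  ... | inj₁ i≤k = ascend i≤k ≤-refl
  ... | inj₂ k≤i = descend k≤i

2*n∸n≡n : ∀ n → 2 * n ∸ n ≡ n
2*n∸n≡n n = trans (cong (λ m → n + m ∸ n) (+-identityʳ n)) (m+n∸n≡m n n)

1+i≤n⇒1+i≤2n∸i : ∀ {n i} → suc i ≤ n → suc i ≤ 2 * n ∸ i
1+i≤n⇒1+i≤2n∸i {n} {i} 1+i≤n =
  m+n≤o⇒m≤o∸n (suc i) (≤-trans (+-mono-≤ 1+i≤n (<⇒≤ 1+i≤n)) (≤-reflexive (cong (n +_) (sym (+-identityʳ n)))))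

n≤i⇒2n∸i≤1+i : ∀ {n i} → n ≤ i → 2 * n ∸ i ≤ suc i
n≤i⇒2n∸i≤1+i {n} {i} n≤i = begin
  2 * n ∸ i  ≤⟨ ∸-monoʳ-≤ (2 * n) n≤i ⟩
  2 * n ∸ n  ≡⟨ 2*n∸n≡n n ⟩
  n          ≤⟨ n≤i ⟩
  i          <⟨ n<1+n i ⟩
  suc i      ∎
  where open ≤-Reasoning

binomial-unimodal : ∀ n → UnimodalWithModeAt (binomial (2 * n)) n
binomial-unimodal n = unimodal-from-steps (binomial (2 * n)) n
  (λ i 1+i≤n → count-increasing all-upClosed (1+i≤n⇒1+i≤2n∸i 1+i≤n))
  (λ i n≤i → binomial-decreasing (n≤i⇒2n∸i≤1+i n≤i))

_⊆ᵇ_ : ∀ {N} → Subset N → Subset N → Bool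
S ⊆ᵇ C = does (S ⊆? C)

count-⊆-< : ∀ {N} (C : Subset N) {k} → ∣ C ∣ < k → count N (_⊆ᵇ C) k ≡ 0
count-⊆-< []            {suc k} _ = refl
count-⊆-< (inside ∷ C)  {suc k} (s≤s ∣C∣<k) =
  trans (∑-allSubsets-suc (𝟙 ∘ layer (_⊆ᵇ (inside ∷ C)) (suc k)))
        (cong₂ _+_ (count-⊆-< C ∣C∣<k) (count-⊆-< C (m<n⇒m<1+n ∣C∣<k)))
count-⊆-< {suc N} (outside ∷ C) {k} ∣C∣<k =
  trans (∑-allSubsets-suc (𝟙 ∘ layer (_⊆ᵇ (outside ∷ C)) k))
        (cong₂ _+_ (∑-zero (allSubsets N)) (count-⊆-< C ∣C∣<k))

count-⊆-≤ : ∀ {N} (C : Subset N) {k} → ∣ C ∣ ≤ k → count N (_⊆ᵇ C) k ≤ 1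
count-⊆-≤ []            {k} _ = ≤-trans (≤-reflexive (+-identityʳ _)) (𝟙≤1 (0 ≡ᵇ k))
count-⊆-≤ {suc N} (inside ∷ C)  {suc k} (s≤s ∣C∣≤k) = begin
  count (suc N) (_⊆ᵇ (inside ∷ C)) (suc k)
    ≡⟨ ∑-allSubsets-suc (𝟙 ∘ layer (_⊆ᵇ (inside ∷ C)) (suc k)) ⟩
  count N (_⊆ᵇ C) k + count N (_⊆ᵇ C) (suc k)
    ≡⟨ cong (count N (_⊆ᵇ C) k +_) (count-⊆-< C (s≤s ∣C∣≤k)) ⟩
  count N (_⊆ᵇ C) k + 0
    ≡⟨ +-identityʳ _ ⟩
  count N (_⊆ᵇ C) k
    ≤⟨ count-⊆-≤ C ∣C∣≤k ⟩
  1 ∎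
  where open ≤-Reasoning
count-⊆-≤ {suc N} (outside ∷ C) {k} ∣C∣≤k = begin
  count (suc N) (_⊆ᵇ (outside ∷ C)) k
    ≡⟨ ∑-allSubsets-suc (𝟙 ∘ layer (_⊆ᵇ (outside ∷ C)) k) ⟩
  ∑ (allSubsets N) (λ _ → 0) + count N (_⊆ᵇ C) k
    ≡⟨ cong (_+ count N (_⊆ᵇ C) k) (∑-zero (allSubsets N)) ⟩
  count N (_⊆ᵇ C) k
    ≤⟨ count-⊆-≤ C ∣C∣≤k ⟩
  1 ∎
  where open ≤-Reasoning

count-complement : ∀ {N} (p : Subset N → Bool) i → binomial N i ≡ count N p i + count N (not ∘ p) i
count-complement {N} p i = trans (∑-cong (allSubsets N) split) (∑-distrib-+ (allSubsets N) _ _)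
  where
  split : ∀ S → 𝟙 (∣ S ∣ ≡ᵇ i) ≡ 𝟙 (layer p i S) + 𝟙 (layer (not ∘ p) i S)
  split S with p S
  ... | true  = sym (+-identityʳ _)
  ... | false = refl

-- Domination

closedNeighbourhood : ∀ {N} → Graph N → Fin N → Subset N
closedNeighbourhood G v = Vec.tabulate (λ u → adj G v u ∨ does (u ≟ v))

degree≡∑ : ∀ {N} (G : Graph N) v → degree G v ≡ ∑ (allFin N) (𝟙 ∘ adj G v)
degree≡∑ {N} G v = length-filter≡∑ (λ u → T? (adj G v u)) (allFin N)

d≡count : ∀ {N} (G : Graph N) i → d G i ≡ count N (does ∘ dominating? G) i
d≡count {N} G i = length-filter≡∑ (λ U → dominating? G U ×-dec (∣ U ∣ ℕ.≟ i)) (allSubsets N)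

∑-∨-≟ : ∀ {N} (f : Fin N → Bool) v → f v ≡ false →
  ∑ (allFin N) (λ u → 𝟙 (f u ∨ does (u ≟ v))) ≡ suc (∑ (allFin N) (𝟙 ∘ f))
∑-∨-≟ {suc N} f zero fv≡false = begin
  ∑ (allFin (suc N)) (λ u → 𝟙 (f u ∨ does (u ≟ zero)))
    ≡⟨ ∑-allFin-suc (λ u → 𝟙 (f u ∨ does (u ≟ zero))) ⟩
  𝟙 (f zero ∨ true) + ∑ (allFin N) (λ u → 𝟙 (f (suc u) ∨ false))
    ≡⟨ cong₂ _+_ (cong 𝟙 (∨-zeroʳ (f zero))) (∑-cong (allFin N) (λ u → cong 𝟙 (∨-identityʳ (f (suc u))))) ⟩
  suc (∑ (allFin N) (𝟙 ∘ f ∘ suc))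
    ≡⟨ cong (λ b → suc (𝟙 b + ∑ (allFin N) (𝟙 ∘ f ∘ suc))) fv≡false ⟨
  suc (𝟙 (f zero) + ∑ (allFin N) (𝟙 ∘ f ∘ suc))
    ≡⟨ cong suc (∑-allFin-suc (𝟙 ∘ f)) ⟨
  suc (∑ (allFin (suc N)) (𝟙 ∘ f))
    ∎
  where open ≡-Reasoning
∑-∨-≟ {suc N} f (suc v) fv≡false = begin
  ∑ (allFin (suc N)) (λ u → 𝟙 (f u ∨ does (u ≟ suc v)))
    ≡⟨ ∑-allFin-suc (λ u → 𝟙 (f u ∨ does (u ≟ suc v))) ⟩
  𝟙 (f zero ∨ false) + ∑ (allFin N) (λ u → 𝟙 (f (suc u) ∨ does (u ≟ v)))
    ≡⟨ cong₂ _+_ (cong 𝟙 (∨-identityʳ (f zero))) (∑-∨-≟ (f ∘ suc) v fv≡false) ⟩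
  𝟙 (f zero) + suc (∑ (allFin N) (𝟙 ∘ f ∘ suc))
    ≡⟨ +-suc _ _ ⟩
  suc (𝟙 (f zero) + ∑ (allFin N) (𝟙 ∘ f ∘ suc))
    ≡⟨ cong suc (∑-allFin-suc (𝟙 ∘ f)) ⟨
  suc (∑ (allFin (suc N)) (𝟙 ∘ f))
    ∎
  where open ≡-Reasoning

∣closedNeighbourhood∣ : ∀ {N} (G : Graph N) v → ∣ closedNeighbourhood G v ∣ ≡ suc (degree G v)
∣closedNeighbourhood∣ {N} G v = begin
  ∣ closedNeighbourhood G v ∣
    ≡⟨ ∣p∣≡∑ (closedNeighbourhood G v) ⟩
  ∑ (allFin N) (𝟙 ∘ lookup (closedNeighbourhood G v))
    ≡⟨ ∑-cong (allFin N) (λ u → cong 𝟙 (lookup∘tabulate (λ u → adj G v u ∨ does (u ≟ v)) u)) ⟩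
  ∑ (allFin N) (λ u → 𝟙 (adj G v u ∨ does (u ≟ v)))
    ≡⟨ ∑-∨-≟ (adj G v) v (irrefl G v) ⟩
  suc (∑ (allFin N) (𝟙 ∘ adj G v))
    ≡⟨ cong suc (degree≡∑ G v) ⟨
  suc (degree G v)
    ∎
  where open ≡-Reasoning

∈-closedNeighbourhood : ∀ {N} (G : Graph N) {u v} → u ∈ closedNeighbourhood G v → Adj G v u ⊎ u ≡ v
∈-closedNeighbourhood G {u} {v} u∈N[v] =
  cases (adj G v u) (u ≟ v) (trans (sym (lookup∘tabulate _ u)) ([]=⇒lookup u∈N[v]))
  where
  cases : ∀ b (u≟v : Dec (u ≡ v)) → b ∨ does u≟v ≡ true → T b ⊎ u ≡ v
  cases true  _            _ = inj₁ _
  cases false (yes u≡v)    _ = inj₂ u≡v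
  cases false (no _)       ()

¬Dominating⇒⊆∁closedNeighbourhood : ∀ {N} (G : Graph N) S → ¬ Dominating G S →
  ∃[ v ] S ⊆ ∁ (closedNeighbourhood G v)
¬Dominating⇒⊆∁closedNeighbourhood {N} G S ¬dom = map₂ avoids (¬∀⟶∃¬ N _ dominated? ¬dom)
  where
  Dominated : Fin N → Set
  Dominated v = v ∈ S ⊎ Σ (Fin N) (λ u → u ∈ S × Adj G v u)

  dominated? : ∀ v → Dec (Dominated v)
  dominated? v = (v ∈? S) ⊎-dec any? (λ u → (u ∈? S) ×-dec T? (adj G v u))

  dominates : ∀ {u v} → u ∈ S → Adj G v u ⊎ u ≡ v → Dominated v
  dominates u∈S (inj₁ vu)   = inj₂ (_ , u∈S , vu)
  dominates u∈S (inj₂ refl) = inj₁ u∈S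

  avoids : ∀ {v} → ¬ Dominated v → S ⊆ ∁ (closedNeighbourhood G v)
  avoids ¬dominated u∈S = x∉p⇒x∈∁p (λ u∈N[v] → ¬dominated (dominates u∈S (∈-closedNeighbourhood G u∈N[v])))

p⊆p[x]≔inside : ∀ {N} (p : Subset N) x → p ⊆ p [ x ]≔ inside
p⊆p[x]≔inside p x {u} u∈p with u ≟ x
... | yes refl = updateAt-updates x p u∈p
... | no u≢x   = updateAt-minimal u x p u≢x u∈p

Dominating-⊆ : ∀ {N} (G : Graph N) {S S′} → S ⊆ S′ → Dominating G S → Dominating G S′
Dominating-⊆ G S⊆S′ dom v = Sum.map S⊆S′ (map₂ (map₁ S⊆S′)) (dom v)

T-does-map : ∀ {a b} {A : Set a} {B : Set b} (a? : Dec A) (b? : Dec B) → (A → B) → T (does a?) → T (does b?)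
T-does-map (yes a) (yes _) _   _ = _
T-does-map (yes a) (no ¬b) a→b _ = ¬b (a→b a)

dominating-upClosed : ∀ {N} (G : Graph N) → UpClosed (does ∘ dominating? G)
dominating-upClosed G S x =
  T-does-map (dominating? G S) (dominating? G (S [ x ]≔ inside)) (Dominating-⊆ G (p⊆p[x]≔inside S x))

nonDominating-bound : ∀ {N} (G : Graph N) i →
  count N (not ∘ does ∘ dominating? G) i ≤ ∑ (allFin N) (λ v → count N (_⊆ᵇ ∁ (closedNeighbourhood G v)) i)
nonDominating-bound {N} G i =
  ≤-trans (∑-mono-≤ (allSubsets N) witness) (≤-reflexive (∑-comm (allSubsets N) (allFin N) _))
  where
  witness : ∀ S → 𝟙 (not (does (dominating? G S)) ∧ (∣ S ∣ ≡ᵇ i))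
                ≤ ∑ (allFin N) (λ v → 𝟙 ((S ⊆ᵇ ∁ (closedNeighbourhood G v)) ∧ (∣ S ∣ ≡ᵇ i)))
  witness S = by-cases (dominating? G S)
    where
    open ≤-Reasoning
    inS : Fin N → ℕ
    inS v = 𝟙 ((S ⊆ᵇ ∁ (closedNeighbourhood G v)) ∧ (∣ S ∣ ≡ᵇ i))
    by-cases : (dom? : Dec (Dominating G S)) → 𝟙 (not (does dom?) ∧ (∣ S ∣ ≡ᵇ i)) ≤ ∑ (allFin N) inS
    by-cases (yes _)   = z≤n
    by-cases (no ¬dom) with ¬Dominating⇒⊆∁closedNeighbourhood G S ¬dom
    ... | v , S⊆C = begin
      𝟙 (∣ S ∣ ≡ᵇ i)      ≡⟨ cong (λ b → 𝟙 (b ∧ (∣ S ∣ ≡ᵇ i))) (dec-true (S ⊆? _) S⊆C) ⟨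
      inS v               ≤⟨ ∈⇒≤∑ inS (∈-allFin v) ⟩
      ∑ (allFin N) inS    ∎

binomial-one : ∀ N → binomial N 1 ≡ N
binomial-one N = begin
  binomial N 1          ≡⟨ *-identityˡ _ ⟨
  1 * binomial N 1      ≡⟨ binomial-step N 0 ⟩
  N * binomial N 0      ≡⟨ cong (N *_) (binomial-zero N) ⟩
  N * 1                 ≡⟨ *-identityʳ N ⟩
  N                     ∎
  where open ≡-Reasoning

binomial-three : ∀ N → 6 * binomial N 3 ≡ N * (N ∸ 1) * (N ∸ 2)
binomial-three N = begin
  6 * binomial N 3                    ≡⟨ *-assoc 2 3 (binomial N 3) ⟩
  2 * (3 * binomial N 3)              ≡⟨ cong (2 *_) (binomial-step N 2) ⟩
  2 * ((N ∸ 2) * binomial N 2)        ≡⟨ *-exchange 2 (N ∸ 2) (binomial N 2) ⟩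
  (N ∸ 2) * (2 * binomial N 2)        ≡⟨ cong ((N ∸ 2) *_) (binomial-step N 1) ⟩
  (N ∸ 2) * ((N ∸ 1) * binomial N 1)  ≡⟨ cong (λ b → (N ∸ 2) * ((N ∸ 1) * b)) (binomial-one N) ⟩
  (N ∸ 2) * ((N ∸ 1) * N)             ≡⟨ *-reverse (N ∸ 2) (N ∸ 1) N ⟩
  N * (N ∸ 1) * (N ∸ 2)               ∎
  where open ≡-Reasoning

-- The slack 2n(4n² − 12n − 4), written for n = 4 + k.
falling-factorial-3-bound : ∀ n → 4 ≤ n → 6 * (suc n * (2 * n)) ≤ 2 * n * (2 * n ∸ 1) * (2 * n ∸ 2)
falling-factorial-3-bound n@(suc (suc (suc (suc k)))) (s≤s (s≤s (s≤s (s≤s z≤n)))) = begin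
  6 * (suc n * (2 * n))
    ≤⟨ m≤m+n _ _ ⟩
  6 * (suc n * (2 * n)) + (8 + 2 * k) * (12 + 20 * k + 4 * (k * k))
    ≡⟨ solve 1 (λ k → con 6 :* ((con 5 :+ k) :* (con 2 :* (con 4 :+ k)))
                        :+ (con 8 :+ con 2 :* k) :* (con 12 :+ con 20 :* k :+ con 4 :* (k :* k))
                      := con 2 :* (con 4 :+ k) :* (con 7 :+ con 2 :* k) :* (con 6 :+ con 2 :* k)) refl k ⟩
  2 * n * (7 + 2 * k) * (6 + 2 * k)
    ≡⟨ cong₂ (λ a b → 2 * n * a * b) (cong (_∸ 1) 2*n≡8+2*k) (cong (_∸ 2) 2*n≡8+2*k) ⟨
  2 * n * (2 * n ∸ 1) * (2 * n ∸ 2)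
    ∎
  where
  open ≤-Reasoning
  2*n≡8+2*k : 2 * n ≡ 8 + 2 * k
  2*n≡8+2*k = solve 1 (λ k → con 2 :* (con 4 :+ k) := con 8 :+ con 2 :* k) refl k

binomial-middle-lower-bound : ∀ {n} → 4 ≤ n → suc n * (2 * n) ≤ binomial (2 * n) n
binomial-middle-lower-bound {n} 4≤n = *-cancelˡ-≤ 6 (begin
  6 * (suc n * (2 * n))                ≤⟨ falling-factorial-3-bound n 4≤n ⟩
  2 * n * (2 * n ∸ 1) * (2 * n ∸ 2)    ≡⟨ binomial-three (2 * n) ⟨
  6 * binomial (2 * n) 3               ≤⟨ *-monoʳ-≤ 6 (proj₂ (proj₂ (binomial-unimodal n)) 3) ⟩
  6 * binomial (2 * n) n               ∎)
  where open ≤-Reasoning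

module _ {n} (G : Graph (2 * n)) (n≤1+degree : ∀ v → n ≤ suc (degree G v)) where

  private
    dominating nonDominating : Subset (2 * n) → Bool
    dominating    = does ∘ dominating? G
    nonDominating = not ∘ dominating

  ∣∁closedNeighbourhood∣≤n : ∀ v → ∣ ∁ (closedNeighbourhood G v) ∣ ≤ n
  ∣∁closedNeighbourhood∣≤n v = begin
    ∣ ∁ (closedNeighbourhood G v) ∣      ≡⟨ ∣∁p∣≡n∸∣p∣ (closedNeighbourhood G v) ⟩
    2 * n ∸ ∣ closedNeighbourhood G v ∣  ≡⟨ cong (2 * n ∸_) (∣closedNeighbourhood∣ G v) ⟩
    2 * n ∸ suc (degree G v)             ≤⟨ ∸-monoʳ-≤ (2 * n) (n≤1+degree v) ⟩
    2 * n ∸ n                            ≡⟨ 2*n∸n≡n n ⟩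
    n                                    ∎
    where open ≤-Reasoning

  nonDominating-above-middle : ∀ {i} → n < i → count (2 * n) nonDominating i ≡ 0
  nonDominating-above-middle {i} n<i = n≤0⇒n≡0 (begin
    count (2 * n) nonDominating i
      ≤⟨ nonDominating-bound G i ⟩
    ∑ (allFin (2 * n)) (λ v → count (2 * n) (_⊆ᵇ ∁ (closedNeighbourhood G v)) i)
      ≡⟨ ∑-cong (allFin (2 * n)) (λ v → count-⊆-< (∁ (closedNeighbourhood G v)) (≤-<-trans (∣∁closedNeighbourhood∣≤n v) n<i)) ⟩
    ∑ (allFin (2 * n)) (λ _ → 0)
      ≡⟨ ∑-zero (allFin (2 * n)) ⟩
    0 ∎)
    where open ≤-Reasoning

  nonDominating-middle : count (2 * n) nonDominating n ≤ 2 * n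
  nonDominating-middle = begin
    count (2 * n) nonDominating n
      ≤⟨ nonDominating-bound G n ⟩
    ∑ (allFin (2 * n)) (λ v → count (2 * n) (_⊆ᵇ ∁ (closedNeighbourhood G v)) n)
      ≤⟨ ∑-mono-≤ (allFin (2 * n)) (λ v → count-⊆-≤ (∁ (closedNeighbourhood G v)) (∣∁closedNeighbourhood∣≤n v)) ⟩
    ∑ (allFin (2 * n)) (λ _ → 1)
      ≡⟨ ∑-allFin-one (2 * n) ⟩
    2 * n ∎
    where open ≤-Reasoning

  d≡binomial-above-middle : ∀ {i} → n < i → d G i ≡ binomial (2 * n) i
  d≡binomial-above-middle {i} n<i = begin
    d G i                                                      ≡⟨ d≡count G i ⟩
    count (2 * n) dominating i                                 ≡⟨ +-identityʳ _ ⟨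
    count (2 * n) dominating i + 0                             ≡⟨ cong (count (2 * n) dominating i +_) (nonDominating-above-middle n<i) ⟨
    count (2 * n) dominating i + count (2 * n) nonDominating i ≡⟨ count-complement dominating i ⟨
    binomial (2 * n) i                                         ∎
    where open ≡-Reasoning

  d-increasing : ∀ i → suc i ≤ n → d G i ≤ d G (suc i)
  d-increasing i 1+i≤n = subst₂ _≤_ (sym (d≡count G i)) (sym (d≡count G (suc i)))
    (count-increasing (dominating-upClosed G) (1+i≤n⇒1+i≤2n∸i 1+i≤n))

  d-middle-step : 4 ≤ n → d G (suc n) ≤ d G n
  d-middle-step 4≤n = subst₂ _≤_ (sym (d≡binomial-above-middle ≤-refl)) (sym (d≡count G n))
    (+-cancelʳ-≤ (e n) (b (suc n)) (D n) (*-cancelˡ-≤ (suc n) (begin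
      suc n * (b (suc n) + e n)           ≡⟨ *-distribˡ-+ (suc n) (b (suc n)) (e n) ⟩
      suc n * b (suc n) + suc n * e n     ≤⟨ +-mono-≤ (≤-reflexive (binomial-step (2 * n) n))
                                                       (*-monoʳ-≤ (suc n) nonDominating-middle) ⟩
      (2 * n ∸ n) * b n + suc n * (2 * n) ≤⟨ +-mono-≤ (≤-reflexive (cong (_* b n) (2*n∸n≡n n)))
                                                       (binomial-middle-lower-bound 4≤n) ⟩
      n * b n + b n                       ≡⟨ +-comm (n * b n) (b n) ⟩
      suc n * b n                         ≡⟨ cong (suc n *_) (count-complement dominating n) ⟩
      suc n * (D n + e n)                 ∎)))
    where
    open ≤-Reasoning
    b D e : ℕ → ℕ
    b = binomial (2 * n)
    D = count (2 * n) dominating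
    e = count (2 * n) nonDominating

  d-decreasing : 4 ≤ n → ∀ i → n ≤ i → d G (suc i) ≤ d G i
  d-decreasing 4≤n i n≤i with m≤n⇒m<n∨m≡n n≤i
  ... | inj₂ refl = d-middle-step 4≤n
  ... | inj₁ n<i  = subst₂ _≤_ (sym (d≡binomial-above-middle (m<n⇒m<1+n n<i))) (sym (d≡binomial-above-middle n<i))
    (proj₁ (proj₂ (binomial-unimodal n)) i n≤i)

  domination-unimodal : 4 ≤ n → UnimodalWithModeAt (d G) n
  domination-unimodal 4≤n = unimodal-from-steps (d G) n d-increasing (d-decreasing 4≤n)

lemma5p1 : (n m : ℕ) (G : Graph (2 * n)) → Regular m G →
    3 ≤ n ∸ 1 → n ∸ 1 ≤ m → m < 2 * n →
    UnimodalWithModeAt (d G) n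
lemma5p1 zero      m G _       ()    _     _
lemma5p1 n@(suc _) m G regular 3≤n∸1 n∸1≤m _ = domination-unimodal G n≤1+degree (s≤s 3≤n∸1)
  where
  n≤1+degree : ∀ v → n ≤ suc (degree G v)
  n≤1+degree v = subst (λ k → n ≤ suc k) (sym (regular v)) (s≤s n∸1≤m)
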